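{- Fix an integer $y \ge 1$ and let $$\mathcal{D}_y = \{(x, C) \in \mathbb{N}^2 : x > y \log_2 3,\ C \ge 1,\ (2^x - 3^y) \mid C\}.$$ Then $\mathcal{D}_y$ is not a semilinear subset of $\mathbb{N}^2$ (equivalently, it is not definable in Presburger arithmetic).
   Context: A set $L \subseteq \mathbb{N}^d$ is linear if $L = \{b + \sum_{i=1}^k \lambda_i v_i : \lambda_i \in \mathbb{N}\}$ for some $b \in \mathbb{N}^d$ and finitely many $v_1,\ldots,v_k \in \mathbb{N}^d$; it is semilinear if it is a finite union of linear sets. Presburger arithmetic is the first-order theory of $(\mathbb{N}, +, <, 0, 1)$. -}

module Defs where

open import Level using (0ℓ)
open import Data.Nat using (ℕ; zero; suc; _+_; _*_; _∸_; _^_; _≤_; _<_)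
open import Data.Nat.Divisibility using (_∣_)
open import Data.Vec using (Vec; []; _∷_; zipWith; map; replicate)
open import Data.List using (List)
open import Data.List.Relation.Unary.Any using (Any)
open import Data.Product using (Σ; ∃; _×_; _,_)
open import Function.Bundles using (_⇔_)
open import Relation.Binary.PropositionalEquality using (_≡_)

ℕ^ : ℕ → Set
ℕ^ d = Vec ℕ d

_⊕_ : ∀ {d} → ℕ^ d → ℕ^ d → ℕ^ d
_⊕_ = zipWith _+_

_⊙_ : ∀ {d} → ℕ → ℕ^ d → ℕ^ d
c ⊙ v = map (c *_) v

lincomb : ∀ {d k} → Vec ℕ k → Vec (ℕ^ d) k → ℕ^ d
lincomb {d} [] [] = replicate d 0
lincomb (l ∷ ls) (v ∷ vs) = (l ⊙ v) ⊕ lincomb ls vs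

record LinearSet (d : ℕ) : Set where
  constructor linear
  field
    k       : ℕ
    base    : ℕ^ d
    periods : Vec (ℕ^ d) k

_∈L_ : ∀ {d} → ℕ^ d → LinearSet d → Set
p ∈L linear k b vs = Σ (Vec ℕ k) λ ls → p ≡ (b ⊕ lincomb ls vs)

IsSemilinear : ∀ {d} → (ℕ^ d → Set) → Set
IsSemilinear {d} S =
  Σ (List (LinearSet d)) λ Ls → ∀ (p : ℕ^ d) → S p ⇔ Any (p ∈L_) Ls

-- D_y = {(x, C) : x > y log₂ 3, C ≥ 1, (2^x − 3^y) ∣ C}.
-- x > y log₂ 3  ⇔  2^x > 3^y  (for natural x, y), so 2^x − 3^y is the
-- truncated difference, which is the true (positive) difference here.
D : ℕ → ℕ^ 2 → Set
D y (x ∷ C ∷ []) = (3 ^ y < 2 ^ x) × (1 ≤ C) × ((2 ^ x ∸ 3 ^ y) ∣ C)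

-- In row x the least point of D_y is (x, 2^x − 3^y), since a positive multiple of
-- 2^x − 3^y is at least 2^x − 3^y.  In a linear set, a representation of a row-minimal
-- point cannot use a vertical period (0, c) with c > 0, for removing it would give a
-- lower point of the same row and the same set.  Every period it does use has positive
-- first coordinate, so its coefficient is at most x and the point's height is at most
-- K (x + 1), with K depending only on the set.  Hence the row minima of a semilinear
-- subset of ℕ² grow at most linearly, while 2^x − 3^y grows exponentially.
module Submission where

open import Defs
open import Level using (0ℓ)
open import Data.Nat using (ℕ; zero; suc; _+_; _*_; _∸_; _^_; _≤_; _<_; z≤n; s≤s; >-nonZero)
open import Data.Nat.Properties
open import Data.Nat.Divisibility using (∣⇒≤; ∣-refl)
open import Data.Nat.Tactic.RingSolver using (solve-∀)
open import Data.Vec using (Vec; []; _∷_; map; sum)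
open import Data.Vec.Properties using (zipWith-assoc; zipWith-comm)
open import Data.List using (List; []; _∷_)
open import Data.List.Relation.Unary.Any using (Any; here; there)
open import Data.Product using (∃; ∃₂; _×_; _,_)
open import Data.Sum using (_⊎_; inj₁; inj₂)
open import Data.Empty using (⊥-elim)
open import Function.Bundles using (Equivalence)
open import Relation.Binary.PropositionalEquality using (_≡_; refl; sym; trans; cong; subst; module ≡-Reasoning)
open import Relation.Nullary using (¬_)
open import Relation.Unary using (Pred; _⊆_)

⊕-assoc : ∀ {d} (u v w : ℕ^ d) → (u ⊕ v) ⊕ w ≡ u ⊕ (v ⊕ w)
⊕-assoc = zipWith-assoc +-assoc

⊕-comm : ∀ {d} (u v : ℕ^ d) → u ⊕ v ≡ v ⊕ u
⊕-comm = zipWith-comm +-comm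

π₁ π₂ : ℕ^ 2 → ℕ
π₁ (x ∷ _ ∷ []) = x
π₂ (_ ∷ C ∷ []) = C

vertical : ℕ → ℕ^ 2
vertical c = 0 ∷ suc c ∷ []

Under : ℕ → ℕ^ 2 → Set
Under M p = π₂ p ≤ π₁ p * M

under-⊙ : ∀ l {M} v → Under M v → Under M (l ⊙ v)
under-⊙ l {M} (a ∷ c ∷ []) c≤aM = ≤-trans (*-monoʳ-≤ l c≤aM) (≤-reflexive (sym (*-assoc l a M)))

under-⊕ : ∀ {M N} u v → Under M u → Under N v → Under (M + N) (u ⊕ v)
under-⊕ {M} {N} (a ∷ c ∷ []) (b ∷ d ∷ []) c≤aM d≤bN = begin
  c + d                      ≤⟨ +-mono-≤ c≤aM d≤bN ⟩
  a * M + b * N              ≤⟨ +-mono-≤ (*-monoˡ-≤ M (m≤m+n a b)) (*-monoˡ-≤ N (m≤n+m b a)) ⟩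
  (a + b) * M + (a + b) * N  ≡⟨ *-distribˡ-+ (a + b) M N ⟨
  (a + b) * (M + N)          ∎
  where open ≤-Reasoning

scaled-under-or-vertical : ∀ l v →
  Under (π₂ v) (l ⊙ v) ⊎ ∃₂ λ l′ c → l ⊙ v ≡ vertical c ⊕ (l′ ⊙ v)
scaled-under-or-vertical l v@(suc a ∷ c ∷ []) = inj₁ (under-⊙ l v (m≤m+n c (a * c)))
scaled-under-or-vertical l v@(zero ∷ zero ∷ []) = inj₁ (under-⊙ l v z≤n)
scaled-under-or-vertical zero (zero ∷ suc c ∷ []) = inj₁ z≤n
scaled-under-or-vertical (suc l) (zero ∷ suc c ∷ []) = inj₂ (l , c , refl)

lincomb-under-or-vertical : ∀ {k} (ls : Vec ℕ k) (vs : Vec (ℕ^ 2) k) →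
  Under (sum (map π₂ vs)) (lincomb ls vs)
  ⊎ ∃₂ λ ls′ c → lincomb ls vs ≡ lincomb ls′ vs ⊕ vertical c
lincomb-under-or-vertical [] [] = inj₁ z≤n
lincomb-under-or-vertical (l ∷ ls) (v ∷ vs)
  with scaled-under-or-vertical l v | lincomb-under-or-vertical ls vs
... | inj₁ term-under | inj₁ rest-under = inj₁ (under-⊕ (l ⊙ v) (lincomb ls vs) term-under rest-under)
... | inj₂ (l′ , c , term≡) | _ = inj₂ (l′ ∷ ls , c , (begin
  (l ⊙ v) ⊕ lincomb ls vs         ≡⟨ cong (_⊕ lincomb ls vs) term≡ ⟩
  (e ⊕ (l′ ⊙ v)) ⊕ lincomb ls vs  ≡⟨ ⊕-assoc e (l′ ⊙ v) (lincomb ls vs) ⟩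
  e ⊕ ((l′ ⊙ v) ⊕ lincomb ls vs)  ≡⟨ ⊕-comm e ((l′ ⊙ v) ⊕ lincomb ls vs) ⟩
  ((l′ ⊙ v) ⊕ lincomb ls vs) ⊕ e  ∎))
  where
  open ≡-Reasoning
  e = vertical c
... | inj₁ _ | inj₂ (ls′ , c , rest≡) = inj₂ (l ∷ ls′ , c , (begin
  (l ⊙ v) ⊕ lincomb ls vs          ≡⟨ cong ((l ⊙ v) ⊕_) rest≡ ⟩
  (l ⊙ v) ⊕ (lincomb ls′ vs ⊕ e)   ≡⟨ ⊕-assoc (l ⊙ v) (lincomb ls′ vs) e ⟨
  ((l ⊙ v) ⊕ lincomb ls′ vs) ⊕ e   ∎))
  where
  open ≡-Reasoning
  e = vertical c

RowMinimal : Pred (ℕ^ 2) 0ℓ → ℕ^ 2 → Set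
RowMinimal S p = S p × (∀ {q} → S q → π₁ q ≡ π₁ p → π₂ p ≤ π₂ q)

RowMinimaLinearlyBounded : Pred (ℕ^ 2) 0ℓ → Set
RowMinimaLinearlyBounded S = ∃ λ K → ∀ p → RowMinimal S p → π₂ p ≤ suc (π₁ p) * K

rowMinimal-restrict : ∀ {S T p} → T ⊆ S → T p → RowMinimal S p → RowMinimal T p
rowMinimal-restrict T⊆S Tp (_ , least) = Tp , λ Tq → least (T⊆S Tq)

raised-not-rowMinimal : ∀ {S} q c → S q → ¬ RowMinimal S (q ⊕ vertical c)
raised-not-rowMinimal q@(_ ∷ C ∷ []) c Sq (_ , least) =
  m+1+n≰m C (least Sq (sym (+-identityʳ (π₁ q))))

under-bounded : ∀ {M} b u → Under M u → π₂ (b ⊕ u) ≤ suc (π₁ (b ⊕ u)) * (π₂ b + M)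
under-bounded {M} (b₁ ∷ b₂ ∷ []) (u₁ ∷ u₂ ∷ []) u₂≤u₁M = begin
  b₂ + u₂                 ≤⟨ +-mono-≤ (m≤m+n b₂ (x * b₂)) u₂≤u₁M ⟩
  suc x * b₂ + u₁ * M     ≤⟨ +-monoʳ-≤ (suc x * b₂) (*-monoˡ-≤ M u₁≤1+x) ⟩
  suc x * b₂ + suc x * M  ≡⟨ *-distribˡ-+ (suc x) b₂ M ⟨
  suc x * (b₂ + M)        ∎
  where
  open ≤-Reasoning
  x = b₁ + u₁
  u₁≤1+x : u₁ ≤ suc x
  u₁≤1+x = ≤-trans (m≤n+m u₁ b₁) (n≤1+n x)

linearSet-rowMinimaLinearlyBounded : (L : LinearSet 2) → RowMinimaLinearlyBounded (_∈L L)
linearSet-rowMinimaLinearlyBounded L@(linear _ b vs) = K , bounded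
  where
  K = π₂ b + sum (map π₂ vs)
  bounded : ∀ p → RowMinimal (_∈L L) p → π₂ p ≤ suc (π₁ p) * K
  bounded p rowMin@((ls , refl) , _) with lincomb-under-or-vertical ls vs
  ... | inj₁ under = under-bounded b (lincomb ls vs) under
  ... | inj₂ (ls′ , c , lincomb≡) =
    ⊥-elim (raised-not-rowMinimal q c (ls′ , refl) (subst (RowMinimal (_∈L L)) p≡q⊕↑ rowMin))
    where
    q = b ⊕ lincomb ls′ vs
    p≡q⊕↑ : b ⊕ lincomb ls vs ≡ q ⊕ vertical c
    p≡q⊕↑ = trans (cong (b ⊕_) lincomb≡) (sym (⊕-assoc b (lincomb ls′ vs) (vertical c)))

union-rowMinimaLinearlyBounded : (Ls : List (LinearSet 2)) →
  RowMinimaLinearlyBounded (λ p → Any (p ∈L_) Ls)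
union-rowMinimaLinearlyBounded [] = 0 , λ { _ (() , _) }
union-rowMinimaLinearlyBounded (L ∷ Ls)
  with linearSet-rowMinimaLinearlyBounded L | union-rowMinimaLinearlyBounded Ls
... | K₁ , bounded₁ | K₂ , bounded₂ = K₁ + K₂ , bounded
  where
  bounded : ∀ p → RowMinimal (λ q → Any (q ∈L_) (L ∷ Ls)) p → π₂ p ≤ suc (π₁ p) * (K₁ + K₂)
  bounded p rowMin@(here p∈L , _) =
    ≤-trans (bounded₁ p (rowMinimal-restrict here p∈L rowMin)) (*-monoʳ-≤ (suc (π₁ p)) (m≤m+n K₁ K₂))
  bounded p rowMin@(there p∈Ls , _) =
    ≤-trans (bounded₂ p (rowMinimal-restrict there p∈Ls rowMin)) (*-monoʳ-≤ (suc (π₁ p)) (m≤n+m K₂ K₁))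

semilinear⇒rowMinimaLinearlyBounded : ∀ {S : Pred (ℕ^ 2) 0ℓ} →
  IsSemilinear S → RowMinimaLinearlyBounded S
semilinear⇒rowMinimaLinearlyBounded (Ls , S⇔) with union-rowMinimaLinearlyBounded Ls
... | K , bounded = K , λ p rowMin@(Sp , _) →
  bounded p (rowMinimal-restrict (Equivalence.from (S⇔ _)) (Equivalence.to (S⇔ p) Sp) rowMin)

D-rowMinimal : ∀ y x → 3 ^ y < 2 ^ x → RowMinimal (D y) (x ∷ 2 ^ x ∸ 3 ^ y ∷ [])
D-rowMinimal y x 3^y<2^x = (3^y<2^x , m<n⇒0<n∸m 3^y<2^x , ∣-refl) , least
  where
  least : ∀ {q} → D y q → π₁ q ≡ x → 2 ^ x ∸ 3 ^ y ≤ π₂ q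
  least {_ ∷ C ∷ []} (_ , C≥1 , gap∣C) refl = ∣⇒≤ {{>-nonZero C≥1}} gap∣C

n<2^n : ∀ n → n < 2 ^ n
n<2^n zero = s≤s z≤n
n<2^n (suc n) = +-mono-≤ (m^n>0 2 n) (≤-trans (n<2^n n) (m≤m+n (2 ^ n) 0))

linear<2^ : ∀ B → ∃ λ x → suc x * B < 2 ^ x
linear<2^ B = a + a , (begin-strict
  suc (a + a) * B       ≡⟨ suc[4B]*B≡B+[2B]*[2B] B ⟩
  B + a * a             <⟨ s≤s (+-mono-≤ (m≤m+n B B) (*-monoʳ-≤ a (n≤1+n a))) ⟩
  suc a * suc a         ≤⟨ *-mono-≤ (n<2^n a) (n<2^n a) ⟩
  2 ^ a * 2 ^ a         ≡⟨ ^-distribˡ-+-* 2 a a ⟨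
  2 ^ (a + a)           ∎)
  where
  open ≤-Reasoning
  a = B + B
  suc[4B]*B≡B+[2B]*[2B] : ∀ B → suc ((B + B) + (B + B)) * B ≡ B + (B + B) * (B + B)
  suc[4B]*B≡B+[2B]*[2B] = solve-∀

affine<2^ : ∀ K A → ∃ λ x → suc x * K + A < 2 ^ x
affine<2^ K A with linear<2^ (K + A)
... | x , lt = x , ≤-<-trans (begin
  suc x * K + A          ≤⟨ +-monoʳ-≤ (suc x * K) (m≤m+n A (x * A)) ⟩
  suc x * K + suc x * A  ≡⟨ *-distribˡ-+ (suc x) K A ⟨
  suc x * (K + A)        ∎) lt
  where open ≤-Reasoning

theorem7p1 : (y : ℕ) → 1 ≤ y → ¬ IsSemilinear (D y)
theorem7p1 y _ semilinear =
  let K , bounded = semilinear⇒rowMinimaLinearlyBounded semilinear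
      x , large = affine<2^ K (3 ^ y)
      3^y<2^x = ≤-<-trans (m≤n+m (3 ^ y) (suc x * K)) large
      gap>bound = m+n≤o⇒m≤o∸n (suc (suc x * K)) large
  in <⇒≱ gap>bound (bounded (x ∷ 2 ^ x ∸ 3 ^ y ∷ []) (D-rowMinimal y x 3^y<2^x))
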